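{- For $n\ge 0$, let $v_n$ be the total number of pairs $(T,P)$, where $T$ is a tiling of the $(1\times n)$-board by $(1\times 1)$-squares and $(1\times 2)$-dominoes, and $P$ is a shortest lattice walk crossing the tiled board in the sense described in the context. Then $$n\,v_n=(n+1)\,v_{n-1}+(n+2)\,v_{n-2}\qquad\text{for all } n\ge 2,$$ with $v_0=1$ and $v_1=2$.
   Context: The $(1\times n)$-board is the rectangle $[0,n]\times[0,1]$ subdivided into $n$ unit cells; its grid segments are the unit edges of these cells. A tiling covers the board with non-overlapping unit squares and dominoes, a domino being the union of two horizontally adjacent cells. Given a tiling, a walk crossing the board is a path along grid segments from the lower-left corner $(0,0)$ to the upper-right corner $(n,1)$ of shortest possible length, i.e. of length $n+1$, consisting of unit right and up steps. The walk may not use any grid segment lying in the interior of a domino, i.e. the segment separating the two cells of a domino. For $n=0$ the board is the single segment from $(0,0)$ to $(0,1)$, there is one empty tiling, and exactly one walk. -}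

module Defs where

open import Data.Nat using (ℕ; zero; suc; _+_; _≡ᵇ_)
open import Data.Bool using (Bool; true; false; _∧_; _∨_; not)
open import Data.List using (List; []; _∷_; map)
open import Data.Nat.ListAction using (sum)
open import Data.Bool.ListAction using (any)
open import Data.Product using (Σ; _×_; _,_)
open import Relation.Binary.PropositionalEquality using (_≡_)

data Tile : Set where
  square domino : Tile

width : Tile → ℕ
width square = 1
width domino = 2

-- A tiling of the (1×n)-board: the tiles listed from left to right,
-- with total width n.
Tiling : ℕ → Set
Tiling n = Σ (List Tile) (λ ts → sum (map width ts) ≡ n)

-- x-coordinates of the vertical unit segments {x}×[0,1] lying in the
-- interior of a domino, given that the tiles start at x-coordinate off.
dominoInteriors : ℕ → List Tile → List ℕ
dominoInteriors off [] = []
dominoInteriors off (square ∷ ts) = dominoInteriors (suc off) ts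
dominoInteriors off (domino ∷ ts) = suc off ∷ dominoInteriors (suc (suc off)) ts

data Step : Set where
  R U : Step

endpoint : ℕ → ℕ → List Step → ℕ × ℕ
endpoint x y [] = (x , y)
endpoint x y (R ∷ s) = endpoint (suc x) y s
endpoint x y (U ∷ s) = endpoint x (suc y) s

-- A walk crossing the (1×n)-board: a path of unit right and up steps from
-- (0,0) to (n,1) (such paths automatically have the shortest length n+1).
Walk : ℕ → Set
Walk n = Σ (List Step) (λ s → endpoint 0 0 s ≡ (n , 1))

-- Vertical segments {x}×[y,y+1] used by a walk started at (x , y),
-- recorded as their lower endpoints (x , y).
verticalSegments : ℕ → ℕ → List Step → List (ℕ × ℕ)
verticalSegments x y [] = []
verticalSegments x y (R ∷ s) = verticalSegments (suc x) y s
verticalSegments x y (U ∷ s) = (x , y) ∷ verticalSegments x (suc y) s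

forbidden : List ℕ → ℕ × ℕ → Bool
forbidden ds (x , zero) = any (λ d → d ≡ᵇ x) ds
forbidden ds (x , suc y) = false

avoids : List Tile → List Step → Bool
avoids ts s = not (any (forbidden (dominoInteriors 0 ts)) (verticalSegments 0 0 s))

TiledWalk : ℕ → Set
TiledWalk n = Σ (Tiling n) λ T → Σ (Walk n) λ P →
  avoids (Data.Product.proj₁ T) (Data.Product.proj₁ P) ≡ true

-- A crossing walk runs along the bottom edge, takes its single up step at
-- some x, and then runs along the top edge; the up step is allowed at every x
-- that is not the middle of a domino. Peeling off the first tile and the first
-- step gives four cases: square and up (the rest is any tiling of n+1 cells),
-- square and right (a crossing of n+1 cells), domino and up (any tiling of n
-- cells), domino and two steps right (a crossing of n cells). Hence
-- v(n+2) = F(n+2) + v(n+1) + v(n) with F the Fibonacci numbers counting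
-- tilings, and the recurrence follows from (n+2) F(n+2) = v(n+1) + 2 v(n),
-- proved by the same induction.
module Submission where

open import Defs
open import Axiom.UniquenessOfIdentityProofs using (module Decidable⇒UIP)
open import Data.Bool using (true; false; _∨_; not)
open import Data.Bool.ListAction using (any)
import Data.Bool.Properties as Bool
open import Data.Empty using (⊥; ⊥-elim)
open import Data.Fin using (Fin)
open import Data.Fin.Permutation using (↔⇒≡)
open import Data.Fin.Properties using (+↔⊎; 0↔⊥)
open import Data.List using (List; []; _∷_; map; replicate)
open import Data.Nat using (ℕ; zero; suc; _+_; _*_; _≡ᵇ_; _≤_; _<_; s≤s)
open import Data.Nat.ListAction using (sum)
open import Data.Nat.Properties
open import Data.Nat.Tactic.RingSolver using (solve)
open import Data.Product using (Σ; _×_; _,_; proj₁; proj₂)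
import Data.Product.Properties as Product
open import Data.Sum using (_⊎_; inj₁; inj₂)
open import Data.Sum.Function.Propositional using (_⊎-cong_)
open import Function using (id; _∘_)
open import Function.Bundles using (_↔_; mk↔ₛ′; Equivalence)
open import Function.Properties.Inverse using (↔-sym; ↔-trans)
open import Relation.Nullary using (¬_)
open import Relation.Binary.PropositionalEquality

open ≡-Reasoning

≡ᵇ-refl : ∀ n → (n ≡ᵇ n) ≡ true
≡ᵇ-refl n = Equivalence.to Bool.T-≡ (≡⇒≡ᵇ n n refl)

≢⇒≡ᵇ-false : ∀ {m n} → m ≢ n → (m ≡ᵇ n) ≡ false
≢⇒≡ᵇ-false {m} {n} m≢n with m ≡ᵇ n in eq
... | false = refl
... | true  = ⊥-elim (m≢n (≡ᵇ⇒≡ m n (Equivalence.from Bool.T-≡ eq)))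

endpoint-≥ : ∀ {x y x′ y′} s → endpoint x y s ≡ (x′ , y′) → x ≤ x′ × y ≤ y′
endpoint-≥ [] refl = ≤-refl , ≤-refl
endpoint-≥ (R ∷ s) eq with endpoint-≥ s eq
... | x< , y≤ = <⇒≤ x< , y≤
endpoint-≥ (U ∷ s) eq with endpoint-≥ s eq
... | x≤ , y< = x≤ , <⇒≤ y<

endpoint-replicate : ∀ x y k → endpoint x y (replicate k R) ≡ (x + k , y)
endpoint-replicate x y zero    = cong (_, y) (sym (+-identityʳ x))
endpoint-replicate x y (suc k) =
  trans (endpoint-replicate (suc x) y k) (cong (_, y) (sym (+-suc x k)))

topWalk-unique : ∀ x k s → endpoint x 1 s ≡ (x + k , 1) → s ≡ replicate k R
topWalk-unique x zero    []      eq = refl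
topWalk-unique x (suc k) []      eq = ⊥-elim (m≢1+m+n x (trans (cong proj₁ eq) (+-suc x k)))
topWalk-unique x zero    (R ∷ s) eq =
  ⊥-elim (<-irrefl (sym (+-identityʳ x)) (proj₁ (endpoint-≥ s eq)))
topWalk-unique x (suc k) (R ∷ s) eq =
  cong (R ∷_) (topWalk-unique (suc x) k s (trans eq (cong (_, 1) (+-suc x k))))
topWalk-unique x k       (U ∷ s) eq = ⊥-elim (<-irrefl refl (proj₂ (endpoint-≥ s eq)))

Avoids : ℕ → List Tile → List Step → Set
Avoids off ts s = not (any (forbidden (dominoInteriors off ts)) (verticalSegments off 0 s)) ≡ true

forbidden-aboveBottom : ∀ ds x y s → any (forbidden ds) (verticalSegments x (suc y) s) ≡ false
forbidden-aboveBottom ds x y []      = refl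
forbidden-aboveBottom ds x y (R ∷ s) = forbidden-aboveBottom ds (suc x) y s
forbidden-aboveBottom ds x y (U ∷ s) = forbidden-aboveBottom ds x (suc y) s

dominoInteriors-> : ∀ {x} off ts → x ≤ off → any (λ d → d ≡ᵇ x) (dominoInteriors off ts) ≡ false
dominoInteriors-> off []             x≤off = refl
dominoInteriors-> off (square ∷ ts) x≤off = dominoInteriors-> (suc off) ts (m≤n⇒m≤1+n x≤off)
dominoInteriors-> off (domino ∷ ts) x≤off
  rewrite ≢⇒≡ᵇ-false (>⇒≢ (s≤s x≤off)) =
  dominoInteriors-> (suc (suc off)) ts (m≤n⇒m≤1+n (m≤n⇒m≤1+n x≤off))

avoids-upFirst : ∀ off ts s → Avoids off ts (U ∷ s)
avoids-upFirst off ts s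
  rewrite dominoInteriors-> off ts ≤-refl
        | forbidden-aboveBottom (dominoInteriors off ts) off 0 s = refl

forbidden-drop : ∀ d ds x y s → d < x →
  any (forbidden (d ∷ ds)) (verticalSegments x y s) ≡ any (forbidden ds) (verticalSegments x y s)
forbidden-drop d ds x y       []      d<x = refl
forbidden-drop d ds x y       (R ∷ s) d<x = forbidden-drop d ds (suc x) y s (m≤n⇒m≤1+n d<x)
forbidden-drop d ds x zero    (U ∷ s) d<x rewrite ≢⇒≡ᵇ-false (<⇒≢ d<x) =
  cong (any (λ d′ → d′ ≡ᵇ x) ds ∨_) (forbidden-drop d ds x 1 s d<x)
forbidden-drop d ds x (suc y) (U ∷ s) d<x = forbidden-drop d ds x (suc (suc y)) s d<x

avoids-pastDomino : ∀ off ts s →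
  Avoids off (domino ∷ ts) (R ∷ R ∷ s) ≡ Avoids (suc (suc off)) ts s
avoids-pastDomino off ts s = cong (λ b → not b ≡ true)
  (forbidden-drop (suc off) (dominoInteriors (suc (suc off)) ts) (suc (suc off)) 0 s ≤-refl)

¬avoids-throughDomino : ∀ off ts s → ¬ Avoids off (domino ∷ ts) (R ∷ U ∷ s)
¬avoids-throughDomino off ts s avoids rewrite ≡ᵇ-refl off with avoids
... | ()

-- Tiled walks on the board [off, off + n] × [0, 1], with the end point e kept
-- free so that peeling off a tile needs no arithmetic on the index.
TiledWalkFrom : ℕ → ℕ → ℕ → Set
TiledWalkFrom off e n =
  Σ (Tiling n) λ T → Σ (Σ (List Step) λ s → endpoint off 0 s ≡ (e , 1)) λ P →
    Avoids off (proj₁ T) (proj₁ P)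

tiling-≡ : ∀ {n} {T T′ : Tiling n} → proj₁ T ≡ proj₁ T′ → T ≡ T′
tiling-≡ {T = ts , p} {.ts , q} refl = cong (ts ,_) (≡-irrelevant p q)

tiledWalkFrom-≡ : ∀ {off e n} {W W′ : TiledWalkFrom off e n} →
  proj₁ (proj₁ W) ≡ proj₁ (proj₁ W′) → proj₁ (proj₁ (proj₂ W)) ≡ proj₁ (proj₁ (proj₂ W′)) → W ≡ W′
tiledWalkFrom-≡ {W = (ts , p) , (s , q) , r} {(.ts , p′) , (.s , q′) , r′} refl refl
  with ≡-irrelevant p p′
     | Decidable⇒UIP.≡-irrelevant (Product.≡-dec _≟_ _≟_) q q′
     | Decidable⇒UIP.≡-irrelevant Bool._≟_ r r′
... | refl | refl | refl = refl

upWalk : ∀ off e k → e ≡ off + k → Σ (List Step) λ s → endpoint off 0 s ≡ (e , 1)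
upWalk off e k e≡ = U ∷ replicate k R , trans (endpoint-replicate off 1 k) (cong (_, 1) (sym e≡))

upWalk-unique : ∀ off e k s → e ≡ off + k → endpoint off 1 s ≡ (e , 1) → s ≡ replicate k R
upWalk-unique off e k s e≡ eq = topWalk-unique off k s (trans eq (cong (_, 1) e≡))

-- Below F m is F (m - 1), and empty for m = 0 where no domino fits.
Below : (ℕ → Set) → ℕ → Set
Below F zero    = ⊥
Below F (suc k) = F k

tiling-split : ∀ m → Tiling (suc m) ↔ (Tiling m ⊎ Below Tiling m)
tiling-split m = mk↔ₛ′ (split m) (unsplit m) (split∘unsplit m) (unsplit∘split m)
  where
  split : ∀ m → Tiling (suc m) → Tiling m ⊎ Below Tiling m
  split m       (square ∷ ts , p) = inj₁ (ts , suc-injective p)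
  split (suc k) (domino ∷ ts , p) = inj₂ (ts , suc-injective (suc-injective p))
  split zero    (domino ∷ ts , ())

  unsplit : ∀ m → Tiling m ⊎ Below Tiling m → Tiling (suc m)
  unsplit m       (inj₁ (ts , p)) = square ∷ ts , cong suc p
  unsplit (suc k) (inj₂ (ts , p)) = domino ∷ ts , cong (2 +_) p

  split∘unsplit : ∀ m T → split m (unsplit m T) ≡ T
  split∘unsplit m       (inj₁ _) = cong inj₁ (tiling-≡ refl)
  split∘unsplit (suc k) (inj₂ _) = cong inj₂ (tiling-≡ refl)

  unsplit∘split : ∀ m T → unsplit m (split m T) ≡ T
  unsplit∘split m       (square ∷ ts , p) = tiling-≡ refl
  unsplit∘split (suc k) (domino ∷ ts , p) = tiling-≡ refl
  unsplit∘split zero    (domino ∷ ts , ())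

FirstTileAndStep : ℕ → ℕ → ℕ → Set
FirstTileAndStep off e m =
  (Tiling m ⊎ TiledWalkFrom (suc off) e m) ⊎
  Below (λ k → Tiling k ⊎ TiledWalkFrom (suc (suc off)) e k) m

module _ {off e : ℕ} where

  splitFirst : ∀ m → TiledWalkFrom off e (suc m) → FirstTileAndStep off e m
  splitFirst m       ((square ∷ ts , p) , (U ∷ s , q) , r) = inj₁ (inj₁ (ts , suc-injective p))
  splitFirst m       ((square ∷ ts , p) , (R ∷ s , q) , r) =
    inj₁ (inj₂ ((ts , suc-injective p) , (s , q) , r))
  splitFirst (suc k) ((domino ∷ ts , p) , (U ∷ s , q) , r) =
    inj₂ (inj₁ (ts , suc-injective (suc-injective p)))
  splitFirst (suc k) ((domino ∷ ts , p) , (R ∷ R ∷ s , q) , r) =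
    inj₂ (inj₂ ((ts , suc-injective (suc-injective p)) , (s , q) ,
                subst id (avoids-pastDomino off ts s) r))
  splitFirst (suc k) ((domino ∷ ts , p) , (R ∷ U ∷ s , q) , r) =
    ⊥-elim (¬avoids-throughDomino off ts s r)
  splitFirst zero    ((domino ∷ ts , ()) , _)
  splitFirst m       ((_ ∷ ts , p) , ([] , ()) , r)
  splitFirst (suc k) ((domino ∷ ts , p) , (R ∷ [] , ()) , r)

  unsplitFirst : ∀ m → e ≡ off + suc m → FirstTileAndStep off e m → TiledWalkFrom off e (suc m)
  unsplitFirst m e≡ (inj₁ (inj₁ (ts , p))) =
    (square ∷ ts , cong suc p) , upWalk off e (suc m) e≡ ,
    avoids-upFirst off (square ∷ ts) (replicate (suc m) R)
  unsplitFirst m e≡ (inj₁ (inj₂ ((ts , p) , (s , q) , r))) =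
    (square ∷ ts , cong suc p) , (R ∷ s , q) , r
  unsplitFirst (suc k) e≡ (inj₂ (inj₁ (ts , p))) =
    (domino ∷ ts , cong (2 +_) p) , upWalk off e (suc (suc k)) e≡ ,
    avoids-upFirst off (domino ∷ ts) (replicate (suc (suc k)) R)
  unsplitFirst (suc k) e≡ (inj₂ (inj₂ ((ts , p) , (s , q) , r))) =
    (domino ∷ ts , cong (2 +_) p) , (R ∷ R ∷ s , q) , subst id (sym (avoids-pastDomino off ts s)) r

  splitFirst∘unsplitFirst : ∀ m e≡ W → splitFirst m (unsplitFirst m e≡ W) ≡ W
  splitFirst∘unsplitFirst m       e≡ (inj₁ (inj₁ _)) = cong (inj₁ ∘ inj₁) (tiling-≡ refl)
  splitFirst∘unsplitFirst m       e≡ (inj₁ (inj₂ _)) = cong (inj₁ ∘ inj₂) (tiledWalkFrom-≡ refl refl)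
  splitFirst∘unsplitFirst (suc k) e≡ (inj₂ (inj₁ _)) = cong (inj₂ ∘ inj₁) (tiling-≡ refl)
  splitFirst∘unsplitFirst (suc k) e≡ (inj₂ (inj₂ _)) = cong (inj₂ ∘ inj₂) (tiledWalkFrom-≡ refl refl)

  unsplitFirst∘splitFirst : ∀ m e≡ W → unsplitFirst m e≡ (splitFirst m W) ≡ W
  unsplitFirst∘splitFirst m       e≡ ((square ∷ ts , p) , (U ∷ s , q) , r) =
    tiledWalkFrom-≡ refl (cong (U ∷_) (sym (upWalk-unique off e (suc m) s e≡ q)))
  unsplitFirst∘splitFirst m       e≡ ((square ∷ ts , p) , (R ∷ s , q) , r) = tiledWalkFrom-≡ refl refl
  unsplitFirst∘splitFirst (suc k) e≡ ((domino ∷ ts , p) , (U ∷ s , q) , r) =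
    tiledWalkFrom-≡ refl (cong (U ∷_) (sym (upWalk-unique off e (suc (suc k)) s e≡ q)))
  unsplitFirst∘splitFirst (suc k) e≡ ((domino ∷ ts , p) , (R ∷ R ∷ s , q) , r) = tiledWalkFrom-≡ refl refl
  unsplitFirst∘splitFirst (suc k) e≡ ((domino ∷ ts , p) , (R ∷ U ∷ s , q) , r) =
    ⊥-elim (¬avoids-throughDomino off ts s r)
  unsplitFirst∘splitFirst zero    e≡ ((domino ∷ ts , ()) , _)
  unsplitFirst∘splitFirst m       e≡ ((_ ∷ ts , p) , ([] , ()) , r)
  unsplitFirst∘splitFirst (suc k) e≡ ((domino ∷ ts , p) , (R ∷ [] , ()) , r)

  tiledWalkFrom-split : ∀ m → e ≡ off + suc m → TiledWalkFrom off e (suc m) ↔ FirstTileAndStep off e m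
  tiledWalkFrom-split m e≡ =
    mk↔ₛ′ (splitFirst m) (unsplitFirst m e≡) (splitFirst∘unsplitFirst m e≡) (unsplitFirst∘splitFirst m e≡)

fib : ℕ → ℕ
fib zero          = 1
fib (suc zero)    = 1
fib (suc (suc n)) = fib (suc n) + fib n

crossings : ℕ → ℕ
crossings zero          = 1
crossings (suc zero)    = 2
crossings (suc (suc n)) = (fib (suc n) + crossings (suc n)) + (fib n + crossings n)

_⊎-fin_ : ∀ {A B : Set} {m n} → A ↔ Fin m → B ↔ Fin n → (A ⊎ B) ↔ Fin (m + n)
f ⊎-fin g = ↔-trans (f ⊎-cong g) (↔-sym +↔⊎)

singleton↔Fin1 : ∀ {A : Set} (x : A) → (∀ y → x ≡ y) → A ↔ Fin 1
singleton↔Fin1 x unique =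
  mk↔ₛ′ (λ _ → Fin.zero) (λ _ → x) (λ { Fin.zero → refl ; (Fin.suc ()) }) unique

tiling-empty : ∀ {ts} → sum (map width ts) ≡ 0 → [] ≡ ts
tiling-empty {[]} p = refl
tiling-empty {square ∷ ts} ()
tiling-empty {domino ∷ ts} ()

tiling↔fib : ∀ n → Tiling n ↔ Fin (fib n)
tiling↔fib zero          = singleton↔Fin1 ([] , refl) λ (ts , p) → tiling-≡ (tiling-empty p)
tiling↔fib (suc zero)    = ↔-trans (tiling-split 0) (tiling↔fib 0 ⊎-fin ↔-sym 0↔⊥)
tiling↔fib (suc (suc n)) = ↔-trans (tiling-split (suc n)) (tiling↔fib (suc n) ⊎-fin tiling↔fib n)

tiledWalkFrom↔crossings : ∀ n off e → e ≡ off + n → TiledWalkFrom off e n ↔ Fin (crossings n)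
tiledWalkFrom↔crossings zero off e e≡ =
  singleton↔Fin1 upOnly unique
  where
  upOnly : TiledWalkFrom off e 0
  upOnly = ([] , refl) , upWalk off e 0 e≡ , avoids-upFirst off [] []

  unique : ∀ W → upOnly ≡ W
  unique ((ts , p) , (U ∷ s , q) , r) =
    tiledWalkFrom-≡ (tiling-empty p) (cong (U ∷_) (sym (upWalk-unique off e 0 s e≡ q)))
  unique ((ts , p) , (R ∷ s , q) , r) =
    ⊥-elim (<-irrefl (sym (+-identityʳ off)) (proj₁ (endpoint-≥ s (trans q (cong (_, 1) e≡)))))
tiledWalkFrom↔crossings (suc zero) off e e≡ =
  ↔-trans (tiledWalkFrom-split 0 e≡)
    ((tiling↔fib 0 ⊎-fin tiledWalkFrom↔crossings 0 (suc off) e (trans e≡ (+-suc off 0))) ⊎-fin ↔-sym 0↔⊥)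
tiledWalkFrom↔crossings (suc (suc n)) off e e≡ =
  ↔-trans (tiledWalkFrom-split (suc n) e≡)
    ((tiling↔fib (suc n) ⊎-fin tiledWalkFrom↔crossings (suc n) (suc off) e e≡₁) ⊎-fin
     (tiling↔fib n ⊎-fin tiledWalkFrom↔crossings n (suc (suc off)) e (trans e≡₁ (cong suc (+-suc off n)))))
  where
  e≡₁ : e ≡ suc off + suc n
  e≡₁ = trans e≡ (+-suc off (suc n))

-- a, b, x, y, z stand for F n, F (n+1), v n, v (n+1), v (n+2), as the terms unfold.
fib-crossings-step : ∀ n a b x y z →
  (3 + n) * ((b + a) + b) ≡ z + 2 * y → (2 + n) * (b + a) ≡ y + 2 * x →
  (4 + n) * (((b + a) + b) + (b + a)) ≡ ((b + a) + z) + (b + y) + 2 * ((b + y) + (a + x))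
fib-crossings-step n a b x y z h₁ h₀ = begin
  (4 + n) * (((b + a) + b) + (b + a))
    ≡⟨ solve (n ∷ a ∷ b ∷ []) ⟩
  (3 + n) * ((b + a) + b) + (2 + n) * (b + a) + (((b + a) + b) + 2 * (b + a))
    ≡⟨ cong (_+ (((b + a) + b) + 2 * (b + a))) (cong₂ _+_ h₁ h₀) ⟩
  (z + 2 * y) + (y + 2 * x) + (((b + a) + b) + 2 * (b + a))
    ≡⟨ solve (a ∷ b ∷ x ∷ y ∷ z ∷ []) ⟩
  ((b + a) + z) + (b + y) + 2 * ((b + y) + (a + x)) ∎

fib-crossings : ∀ n → (2 + n) * fib (2 + n) ≡ crossings (1 + n) + 2 * crossings n
fib-crossings zero          = refl
fib-crossings (suc zero)    = refl
fib-crossings (suc (suc n)) =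
  fib-crossings-step n (fib n) (fib (suc n)) (crossings n) (crossings (suc n)) (crossings (2 + n))
    (fib-crossings (suc n)) (fib-crossings n)

crossings-recurrence-step : ∀ n a b x y → (2 + n) * (b + a) ≡ y + 2 * x →
  (2 + n) * ((b + y) + (a + x)) ≡ (3 + n) * y + (4 + n) * x
crossings-recurrence-step n a b x y h = begin
  (2 + n) * ((b + y) + (a + x))       ≡⟨ solve (n ∷ a ∷ b ∷ x ∷ y ∷ []) ⟩
  (2 + n) * (b + a) + (2 + n) * (y + x) ≡⟨ cong (_+ (2 + n) * (y + x)) h ⟩
  (y + 2 * x) + (2 + n) * (y + x)     ≡⟨ solve (n ∷ x ∷ y ∷ []) ⟩
  (3 + n) * y + (4 + n) * x           ∎

crossings-recurrence : ∀ n →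
  (2 + n) * crossings (2 + n) ≡ (3 + n) * crossings (1 + n) + (4 + n) * crossings n
crossings-recurrence n =
  crossings-recurrence-step n (fib n) (fib (suc n)) (crossings n) (crossings (suc n)) (fib-crossings n)

theorem1 : (v : ℕ → ℕ) → (∀ n → Fin (v n) ↔ TiledWalk n) →
    (v 0 ≡ 1) × (v 1 ≡ 2) ×
    (∀ n → suc (suc n) * v (suc (suc n)) ≡ suc (suc (suc n)) * v (suc n) + suc (suc (suc (suc n))) * v n)
theorem1 v v-counts = v≡crossings 0 , v≡crossings 1 , recurrence
  where
  v≡crossings : ∀ n → v n ≡ crossings n
  v≡crossings n = ↔⇒≡ (↔-trans (v-counts n) (tiledWalkFrom↔crossings n 0 n refl))

  recurrence : ∀ n → suc (suc n) * v (suc (suc n)) ≡ suc (suc (suc n)) * v (suc n) + suc (suc (suc (suc n))) * v n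
  recurrence n rewrite v≡crossings n | v≡crossings (suc n) | v≡crossings (suc (suc n)) =
    crossings-recurrence n
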